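{- Let $m\geq0$ and $n\geq1$ be integers and let $c\in\mathcal{C}_{n,m}$. Then for $1\le r\le n+m$, \[ \overline U_{r}(c)=\#\{(i,j):c_{ij}=r\}+\#\{k:\ 1\leq k<r,\ c_{1,n+m-k}=k\}. \] In particular $\overline U_1(c)$ is the number of entries equal to $1$ in $c$, $\overline U_{n+m}(c)$ is the number of saturated parts of $c$, and $\overline U_{n+m-1}(c)=\overline U_{n+m}(c)$.
   Context: $\mathcal{C}_{n,m}$ is the set of plane partitions $c=(c_{ij})_{i,j\geq1}$ (nonnegative integer arrays with finitely many nonzero entries, weakly decreasing along rows and columns) with at most $n$ nonzero columns, nonzero entries strictly decreasing down columns, and each nonzero entry in column $j$ at most $n+m-j$; entries outside the support are $0$. A saturated part is an entry $c_{1j}=n+m-j>0$. $\mathcal{T}_{n,m}$ is the set of arrays $b=(b_{ij})_{1\leq i\leq j\leq n+m-1}$ of integers weakly decreasing along rows and columns with $\max\{n-i,0\}\le b_{ij}\le n$. $\Phi_{n,m}:\mathcal{C}_{n,m}\to\mathcal{T}_{n,m}$ maps $c$ to $b$ with $b_{ij}=n-\#\{l: c_{n+m-j,l}\geq1-i+j\}$. For $b\in\mathcal{T}_{n,m}$, with conventions $b_{i,n+m}=n-i$ and $b_{0,j}=n$, and $1\le r\le n+m$, $U_r(b)=\sum_{s=1}^{n+m-r}(b_{s,s+r-1}-b_{s,s+r})+\sum_{s=n+m-r+1}^{n+m-1}\chi\{b_{s,n+m-1}>n-s\}$ ($\chi\{P\}=1$ if $P$ holds, else $0$). For $c\in\mathcal{C}_{n,m}$,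 $\overline U_r(c)=n+m-1-U_r(\Phi_{n,m}(c))$. -}

module Defs where

open import Data.Nat using (ℕ; zero; suc; _+_; _∸_; _≤_; _<_; _≡ᵇ_; _≤ᵇ_; _<ᵇ_)
open import Data.Integer using (ℤ; +_) renaming (_+_ to _+ℤ_; _-_ to _-ℤ_; _<?_ to _<ℤ?_)
open import Data.Bool using (Bool; true; false; if_then_else_; _∧_)
open import Data.List using (List; []; _∷_; map; upTo; foldr)
open import Data.Product using (∃)
open import Relation.Nullary using (does)
open import Relation.Binary.PropositionalEquality using (_≡_)

-- Conventions: all arrays are 1-indexed; an array is a function ℕ → ℕ → ℕ
-- whose values at index 0 are irrelevant (never used).

range : ℕ → ℕ → List ℕ
range lo hi = map (λ k → lo + k) (upTo (suc hi ∸ lo))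

countᵇ : (ℕ → Bool) → List ℕ → ℕ
countᵇ p [] = 0
countᵇ p (x ∷ xs) = if p x then suc (countᵇ p xs) else countᵇ p xs

sumℤ : (ℕ → ℤ) → List ℕ → ℤ
sumℤ f = foldr (λ x acc → f x +ℤ acc) (+ 0)

PlaneArray : Set
PlaneArray = ℕ → ℕ → ℕ

record InC (n m : ℕ) (c : PlaneArray) : Set where
  field
    finite    : ∃ λ N → ∀ i j → 1 ≤ i → 1 ≤ j → N < i + j → c i j ≡ 0
    rowDec    : ∀ i j → 1 ≤ i → 1 ≤ j → c i (suc j) ≤ c i j
    colDec    : ∀ i j → 1 ≤ i → 1 ≤ j → c (suc i) j ≤ c i j
    -- at most n nonzero columns (the nonzero columns form a prefix, rows decrease)
    atMostN   : ∀ i j → 1 ≤ i → n < j → c i j ≡ 0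
    colStrict : ∀ i j → 1 ≤ i → 1 ≤ j → 0 < c (suc i) j → c (suc i) j < c i j
    bound     : ∀ i j → 1 ≤ i → 1 ≤ j → 0 < c i j → c i j ≤ n + m ∸ j

-- Φ_{n,m}(c) = b, b_{ij} = n - #{l : c_{n+m-j,l} ≥ 1-i+j}, for 1 ≤ i ≤ j ≤ n+m-1.
-- (Nonzero entries of c lie in columns ≤ n+m-1, so counting l ∈ [1, n+m] counts all l.)
Φ : ℕ → ℕ → PlaneArray → ℕ → ℕ → ℤ
Φ n m c i j = + n -ℤ + countᵇ (λ l → (suc j ∸ i) ≤ᵇ c (n + m ∸ j) l) (range 1 (n + m))

bExt : ℕ → ℕ → (ℕ → ℕ → ℤ) → ℕ → ℕ → ℤ
bExt n m b i j =
  if i ≡ᵇ 0 then + n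
  else if j ≡ᵇ (n + m) then + n -ℤ + i
  else b i j

χ : Bool → ℤ
χ true = + 1
χ false = + 0

U : ℕ → ℕ → (ℕ → ℕ → ℤ) → ℕ → ℤ
U n m b r =
  sumℤ (λ s → bExt n m b s (s + r ∸ 1) -ℤ bExt n m b s (s + r)) (range 1 (n + m ∸ r))
  +ℤ sumℤ (λ s → χ (does ((+ n -ℤ + s) <ℤ? bExt n m b s (n + m ∸ 1))))
          (range (n + m ∸ r + 1) (n + m ∸ 1))

Ubar : ℕ → ℕ → ℕ → PlaneArray → ℤ
Ubar n m r c = + (n + m ∸ 1) -ℤ U n m (Φ n m c) r

-- #{(i,j) : c_{ij} = r} (for r ≥ 1 and c ∈ 𝒞_{n,m}, all such (i,j) lie in [1,n+m]²)
countEntries : ℕ → ℕ → ℕ → PlaneArray → ℕ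
countEntries n m r c =
  foldr (λ i acc → countᵇ (λ j → c i j ≡ᵇ r) (range 1 (n + m)) + acc) 0 (range 1 (n + m))

countSat : ℕ → ℕ → ℕ → PlaneArray → ℕ
countSat n m r c = countᵇ (λ k → c 1 (n + m ∸ k) ≡ᵇ k) (range 1 (r ∸ 1))

saturated : ℕ → ℕ → PlaneArray → ℕ
saturated n m c = countᵇ (λ j → (c 1 j ≡ᵇ (n + m ∸ j)) ∧ (0 <ᵇ c 1 j)) (range 1 (n + m))

-- Write A p t for the number of entries ≥ t in row p of c and N = n + m, so that
-- b = Φ c has b i j = n - A (N - j) (j + 1 - i), and A p t - A p (t + 1) counts the
-- entries of row p equal to t. Along the r-th diagonal, for p = N - r - s ≥ 1,
-- b s (s+r-1) - b s (s+r) = A p (r+1) - A (p+1) r; the first sum of U_r telescopes,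
-- and since c i j ≤ N + 1 - i - j no row below N - r holds an entry ≥ r, the sum is
-- N - r minus the number of entries equal to r. In the second sum,
-- b s (N-1) = n - A 1 (N - s); row 1 decreases with c 1 l ≤ N - l, so this count is s
-- when c 1 s = N - s and smaller otherwise: each χ-term is 1 minus the indicator of a
-- saturated part in column s. Adding up, U_r = N - 1 - Ū_r for the claimed Ū_r.
-- No entry equals N, and only c 1 1 can equal N - 1, which is also the one saturated
-- part counted at r = N but not at r = N - 1.

module Submission where

open import Algebra.Properties.CommutativeSemigroup using (interchange)
open import Data.Bool using (Bool; true; false; _∧_; if_then_else_)
open import Data.Bool.Properties using (∧-identityʳ; ∧-zeroʳ)
open import Data.Integer
  using (ℤ; +_; 0ℤ; 1ℤ; +≤+; +<+)
  renaming (_+_ to _+ℤ_; _-_ to _-ℤ_; _≤_ to _≤ℤ_; _<_ to _<ℤ_; _<?_ to _<ℤ?_)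
import Data.Integer.Properties as ℤ
import Data.Integer.Tactic.RingSolver as ℤ-Solver
open import Data.List using ([]; _∷_; foldr; applyUpTo)
open import Data.List.Properties using (map-applyUpTo)
open import Data.Nat using (ℕ; zero; suc; _+_; _∸_; _≤_; _<_; z≤n; s≤s; z<s; _≡ᵇ_; _≤ᵇ_; _<ᵇ_)
open import Data.Nat.Properties
import Data.Nat.Tactic.RingSolver as ℕ-Solver
open import Data.Product using (_×_; _,_)
open import Data.Sum using (inj₁; inj₂)
open import Function using (_∘_; id)
open import Relation.Nullary using (Dec; does; ¬_; yes; no)
open import Relation.Nullary.Decidable using (dec-true; dec-false)
open import Relation.Binary.PropositionalEquality
open ≡-Reasoning
open import Defs

∑ : ℕ → (ℕ → ℤ) → ℤ
∑ zero    f = 0ℤ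
∑ (suc K) f = ∑ K f +ℤ f K

syntax ∑ K (λ k → e) = ∑[ k < K ] e

∑-cong : ∀ K {f g : ℕ → ℤ} → (∀ k → k < K → f k ≡ g k) → ∑ K f ≡ ∑ K g
∑-cong zero    f≗g = refl
∑-cong (suc K) f≗g = cong₂ _+ℤ_ (∑-cong K (λ k k<K → f≗g k (m<n⇒m<1+n k<K))) (f≗g K ≤-refl)

∑-head : ∀ K (f : ℕ → ℤ) → ∑ (suc K) f ≡ f 0 +ℤ ∑[ k < K ] f (suc k)
∑-head zero    f = ℤ.+-comm 0ℤ (f 0)
∑-head (suc K) f = trans (cong (_+ℤ f (suc K)) (∑-head K f)) (ℤ.+-assoc (f 0) _ _)

∑-reverse : ∀ K (f : ℕ → ℤ) → ∑ K f ≡ ∑[ k < K ] f (K ∸ suc k)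
∑-reverse zero    f = refl
∑-reverse (suc K) f = begin
  ∑ K f +ℤ f K                      ≡⟨ cong (_+ℤ f K) (∑-reverse K f) ⟩
  ∑[ k < K ] f (K ∸ suc k) +ℤ f K   ≡⟨ ℤ.+-comm _ (f K) ⟩
  f K +ℤ ∑[ k < K ] f (K ∸ suc k)   ≡⟨ ∑-head K (λ k → f (suc K ∸ suc k)) ⟨
  ∑[ k < suc K ] f (suc K ∸ suc k)  ∎

∑-distrib-+ : ∀ K (f g : ℕ → ℤ) → ∑[ k < K ] (f k +ℤ g k) ≡ ∑ K f +ℤ ∑ K g
∑-distrib-+ zero    f g = refl
∑-distrib-+ (suc K) f g =
  trans (cong (_+ℤ (f K +ℤ g K)) (∑-distrib-+ K f g))
        (interchange ℤ.+-commutativeSemigroup (∑ K f) (∑ K g) (f K) (g K))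

[a-b]+[b-c]≡a-c : ∀ a b c → (a -ℤ b) +ℤ (b -ℤ c) ≡ a -ℤ c
[a-b]+[b-c]≡a-c = ℤ-Solver.solve-∀

∑-telescope : ∀ K (f : ℕ → ℤ) → ∑[ k < K ] (f k -ℤ f (suc k)) ≡ f 0 -ℤ f K
∑-telescope zero    f = sym (ℤ.+-inverseʳ (f 0))
∑-telescope (suc K) f =
  trans (cong (_+ℤ (f K -ℤ f (suc K))) (∑-telescope K f)) ([a-b]+[b-c]≡a-c (f 0) (f K) (f (suc K)))

∑-ones : ∀ K → ∑[ k < K ] 1ℤ ≡ + K
∑-ones zero    = refl
∑-ones (suc K) = trans (cong (_+ℤ 1ℤ) (∑-ones K)) (cong +_ (+-comm K 1))

∑-mono-≤ : ∀ K {f g : ℕ → ℤ} → (∀ k → k < K → f k ≤ℤ g k) → ∑ K f ≤ℤ ∑ K g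
∑-mono-≤ zero    f≤g = ℤ.≤-refl
∑-mono-≤ (suc K) f≤g = ℤ.+-mono-≤ (∑-mono-≤ K (λ k k<K → f≤g k (m<n⇒m<1+n k<K))) (f≤g K ≤-refl)

∑-truncate : ∀ {M K} (f : ℕ → ℤ) → M ≤ K → (∀ k → M ≤ k → k < K → f k ≡ 0ℤ) → ∑ K f ≡ ∑ M f
∑-truncate {K = zero}      f z≤n _   = refl
∑-truncate {M} {K = suc K} f M≤1+K f≡0 with m≤n⇒m<n∨m≡n M≤1+K
... | inj₂ refl      = refl
... | inj₁ (s≤s M≤K) = begin
  ∑ K f +ℤ f K   ≡⟨ cong₂ _+ℤ_ (∑-truncate f M≤K (λ k M≤k k<K → f≡0 k M≤k (m<n⇒m<1+n k<K)))
                               (f≡0 K M≤K ≤-refl) ⟩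
  ∑ M f +ℤ 0ℤ    ≡⟨ ℤ.+-identityʳ _ ⟩
  ∑ M f          ∎

∑-zero : ∀ K (f : ℕ → ℤ) → (∀ k → k < K → f k ≡ 0ℤ) → ∑ K f ≡ 0ℤ
∑-zero K f f≡0 = ∑-truncate f z≤n (λ k _ → f≡0 k)

χ-does-true : ∀ {A : Set} (a? : Dec A) → A → χ (does a?) ≡ 1ℤ
χ-does-true a? a = cong χ (dec-true a? a)

χ-does-false : ∀ {A : Set} (a? : Dec A) → ¬ A → χ (does a?) ≡ 0ℤ
χ-does-false a? ¬a = cong χ (dec-false a? ¬a)

∑-χ≤ : ∀ K (p : ℕ → Bool) → ∑[ k < K ] χ (p k) ≤ℤ + K
∑-χ≤ K p = ℤ.≤-trans (∑-mono-≤ K (λ k _ → χ≤1 (p k))) (ℤ.≤-reflexive (∑-ones K))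
  where
  χ≤1 : ∀ b → χ b ≤ℤ 1ℤ
  χ≤1 true  = ℤ.≤-refl
  χ≤1 false = +≤+ z≤n

χ-≤ᵇ-split : ∀ t x → χ (t ≤ᵇ x) ≡ χ (suc t ≤ᵇ x) +ℤ χ (x ≡ᵇ t)
χ-≤ᵇ-split zero          zero    = refl
χ-≤ᵇ-split zero          (suc x) = refl
χ-≤ᵇ-split (suc t)       zero    = refl
χ-≤ᵇ-split (suc zero)    (suc x) = χ-≤ᵇ-split zero x
χ-≤ᵇ-split (suc (suc t)) (suc x) = χ-≤ᵇ-split (suc t) x

≡ᵇ-suc-∧-positive : ∀ x y → ((x ≡ᵇ suc y) ∧ (0 <ᵇ x)) ≡ (x ≡ᵇ suc y)
≡ᵇ-suc-∧-positive zero    y = refl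
≡ᵇ-suc-∧-positive (suc x) y = ∧-identityʳ (x ≡ᵇ y)

countᵇ-sumℤ : ∀ p xs → + countᵇ p xs ≡ sumℤ (χ ∘ p) xs
countᵇ-sumℤ p []       = refl
countᵇ-sumℤ p (x ∷ xs) with p x
... | true  = cong (1ℤ +ℤ_) (countᵇ-sumℤ p xs)
... | false = trans (countᵇ-sumℤ p xs) (sym (ℤ.+-identityˡ _))

foldr-+-sumℤ : ∀ (g : ℕ → ℕ) xs → + foldr (λ x acc → g x + acc) 0 xs ≡ sumℤ (λ x → + g x) xs
foldr-+-sumℤ g []       = refl
foldr-+-sumℤ g (x ∷ xs) = cong (+ g x +ℤ_) (foldr-+-sumℤ g xs)

sumℤ-applyUpTo : ∀ (f : ℕ → ℤ) g K → sumℤ f (applyUpTo g K) ≡ ∑[ k < K ] f (g k)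
sumℤ-applyUpTo f g zero    = refl
sumℤ-applyUpTo f g (suc K) =
  trans (cong (f (g 0) +ℤ_) (sumℤ-applyUpTo f (g ∘ suc) K)) (sym (∑-head K (f ∘ g)))

sumℤ-range : ∀ (f : ℕ → ℤ) {lo len hi} → lo + len ≡ suc hi →
             sumℤ f (range lo hi) ≡ ∑[ k < len ] f (lo + k)
sumℤ-range f {lo} {len} {hi} lo+len≡1+hi = begin
  sumℤ f (range lo hi)                    ≡⟨ cong (sumℤ f) (map-applyUpTo id shift (suc hi ∸ lo)) ⟩
  sumℤ f (applyUpTo shift (suc hi ∸ lo))  ≡⟨ sumℤ-applyUpTo f shift (suc hi ∸ lo) ⟩
  ∑[ k < suc hi ∸ lo ] f (lo + k)         ≡⟨ cong (λ L → ∑[ k < L ] f (lo + k)) length ⟩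
  ∑[ k < len ] f (lo + k)                 ∎
  where
  shift : ℕ → ℕ
  shift k = lo + k

  length : suc hi ∸ lo ≡ len
  length = trans (cong (_∸ lo) (sym lo+len≡1+hi)) (m+n∸m≡n lo len)

countᵇ-range : ∀ p {lo len hi} → lo + len ≡ suc hi →
               + countᵇ p (range lo hi) ≡ ∑[ k < len ] χ (p (lo + k))
countᵇ-range p {lo} {len} {hi} lo+len≡1+hi =
  trans (countᵇ-sumℤ p (range lo hi)) (sumℤ-range (χ ∘ p) {lo} {len} lo+len≡1+hi)

+-suc-≤ : ∀ {a q} b → a ≤ q → a + suc b ≤ suc q + b
+-suc-≤ {a} b a≤q = ≤-trans (≤-reflexive (+-suc a b)) (s≤s (+-monoˡ-≤ b a≤q))

[a-x]-[a-y]≡y-x : ∀ a x y → (a -ℤ x) -ℤ (a -ℤ y) ≡ y -ℤ x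
[a-x]-[a-y]≡y-x = ℤ-Solver.solve-∀

[x-y]+e≡[x+e]-y : ∀ x y e → (x -ℤ y) +ℤ e ≡ (x +ℤ e) -ℤ y
[x-y]+e≡[x+e]-y = ℤ-Solver.solve-∀

[a-e]+[[k-a]+e]≡k : ∀ a e k → (a -ℤ e) +ℤ ((k -ℤ a) +ℤ e) ≡ k
[a-e]+[[k-a]+e]≡k = ℤ-Solver.solve-∀

complements-difference : ∀ x y a b {k r} → x +ℤ a ≡ k → y +ℤ b ≡ r → (k +ℤ r) -ℤ (x +ℤ y) ≡ a +ℤ b
complements-difference x y a b refl refl = identity x y a b
  where
  identity : ∀ x y a b → ((x +ℤ a) +ℤ (y +ℤ b)) -ℤ (x +ℤ y) ≡ a +ℤ b
  identity = ℤ-Solver.solve-∀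

module _ {n m : ℕ} {c : PlaneArray} (c∈C : InC n m c) where
  open InC c∈C

  private
    N : ℕ
    N = n + m

    b : ℕ → ℕ → ℤ
    b = bExt n m (Φ n m c)

  -- Thanks to truncated subtraction this also holds for the zero entries.
  entry-bound : ∀ i j → c (suc i) (suc j) ≤ N ∸ suc (i + j)
  entry-bound zero j with c 1 (suc j) | bound 1 (suc j) (s≤s z≤n) (s≤s z≤n)
  ... | zero  | _       = z≤n
  ... | suc _ | bounded = bounded z<s
  entry-bound (suc i) j with c (suc (suc i)) (suc j) | colStrict (suc i) (suc j) (s≤s z≤n) (s≤s z≤n)
  ... | zero  | _         = z≤n
  ... | suc x | decreases =
    subst (suc x ≤_) (pred[m∸n]≡m∸[1+n] N (suc (i + j)))
          (<⇒≤pred (<-≤-trans (decreases z<s) (entry-bound i j)))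

  entry≤ : ∀ {K t} i j → K + suc t ≡ N → K ≤ i + j → c (suc i) (suc j) ≤ t
  entry≤ {K} {t} i j K+1+t≡N K≤i+j =
    ≤-trans (entry-bound i j)
            (m≤n+o⇒m∸n≤o N (suc (i + j)) (subst (_≤ suc (i + j) + t) K+1+t≡N (+-suc-≤ t K≤i+j)))

  row1-antitone : ∀ {j} l → 1 ≤ j → j ≤ l → c 1 l ≤ c 1 j
  row1-antitone zero    (s≤s _) ()
  row1-antitone (suc l) 1≤j j≤1+l with m≤n⇒m<n∨m≡n j≤1+l
  ... | inj₂ refl       = ≤-refl
  ... | inj₁ (s≤s j≤l) = ≤-trans (rowDec 1 l (s≤s z≤n) (≤-trans 1≤j j≤l)) (row1-antitone l 1≤j j≤l)

  count≥ count≡ : ℕ → ℕ → ℤ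
  count≥ q t = ∑[ l < N ] χ (t ≤ᵇ c q (suc l))
  count≡ q t = ∑[ l < N ] χ (c q (suc l) ≡ᵇ t)

  count≥-split : ∀ q t → count≥ q t ≡ count≥ q (suc t) +ℤ count≡ q t
  count≥-split q t = trans (∑-cong N (λ l _ → χ-≤ᵇ-split t (c q (suc l)))) (∑-distrib-+ N _ _)

  count≥-vanishes : ∀ {K t} q → K + suc t ≡ N → K ≤ q → count≥ (suc q) (suc t) ≡ 0ℤ
  count≥-vanishes q K+1+t≡N K≤q = ∑-zero N _ λ l _ →
    χ-does-false (_ ≤? _) (λ t<c → <⇒≱ t<c (entry≤ q l K+1+t≡N (≤-trans K≤q (m≤m+n q l))))

  count≡-vanishes : ∀ {K t} q → K + suc t ≡ N → K ≤ q → count≡ (suc q) (suc t) ≡ 0ℤ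
  count≡-vanishes q K+1+t≡N K≤q = ∑-zero N _ λ l _ →
    χ-does-false (_ ≟ _) λ c≡1+t →
      1+n≰n (subst (_≤ _) c≡1+t (entry≤ q l K+1+t≡N (≤-trans K≤q (m≤m+n q l))))

  countEntries-rows : ∀ K R → K + suc R ≡ N →
                      + countEntries n m (suc R) c ≡ ∑[ q < K ] count≡ (suc q) (suc R)
  countEntries-rows K R K+1+R≡N = begin
    + countEntries n m (suc R) c                ≡⟨ foldr-+-sumℤ _ (range 1 N) ⟩
    sumℤ entriesInRow (range 1 N)              ≡⟨ sumℤ-range entriesInRow {1} {N} refl ⟩
    ∑[ q < N ] entriesInRow (suc q)            ≡⟨ ∑-cong N (λ q _ → countᵇ-range _ {1} {N} refl) ⟩
    ∑[ q < N ] count≡ (suc q) (suc R)          ≡⟨ ∑-truncate _ K≤N vanishing ⟩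
    ∑[ q < K ] count≡ (suc q) (suc R)          ∎
    where
    entriesInRow : ℕ → ℤ
    entriesInRow i = + countᵇ (λ j → c i j ≡ᵇ suc R) (range 1 N)
    vanishing : ∀ q → K ≤ q → q < N → count≡ (suc q) (suc R) ≡ 0ℤ
    vanishing q K≤q _ = count≡-vanishes q K+1+R≡N K≤q
    K≤N : K ≤ N
    K≤N = subst (K ≤_) K+1+R≡N (m≤m+n K (suc R))

  b-interior : ∀ i {j p t} → j + suc p ≡ N → i + t ≡ j → b (suc i) j ≡ + n -ℤ count≥ (suc p) t
  b-interior i {j} {p} {t} j+1+p≡N i+t≡j = begin
    b (suc i) j
      ≡⟨ cong (λ β → if β then + n -ℤ + suc i else Φ n m c (suc i) j) (dec-false (j ≟ N) j≢N) ⟩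
    Φ n m c (suc i) j
      ≡⟨ cong (+ n -ℤ_) (countᵇ-range _ {1} {N} refl) ⟩
    + n -ℤ count≥ (N ∸ j) (j ∸ i)
      ≡⟨ cong₂ (λ q s → + n -ℤ count≥ q s) row column ⟩
    + n -ℤ count≥ (suc p) t ∎
    where
    j≢N : j ≢ N
    j≢N j≡N = m+1+n≢m j (trans j+1+p≡N (sym j≡N))
    row : N ∸ j ≡ suc p
    row = trans (cong (_∸ j) (sym j+1+p≡N)) (m+n∸m≡n j (suc p))
    column : j ∸ i ≡ t
    column = trans (cong (_∸ i) (sym i+t≡j)) (m+n∸m≡n i t)

  b-boundary : ∀ i → b (suc i) N ≡ + n -ℤ + suc i
  b-boundary i = cong (λ β → if β then + n -ℤ + suc i else Φ n m c (suc i) N) (dec-true (N ≟ N) refl)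

  diagonalStep : ℕ → ℕ → ℤ
  diagonalStep r s = b s (s + r ∸ 1) -ℤ b s (s + r)

  diagonalStep-interior : ∀ k R p → suc k + suc R + suc p ≡ N →
    diagonalStep (suc R) (suc k) ≡ count≥ (suc p) (suc (suc R)) -ℤ count≥ (suc (suc p)) (suc R)
  diagonalStep-interior k R p 1+k+1+R+1+p≡N = begin
    b (suc k) (k + suc R) -ℤ b (suc k) (suc (k + suc R))
      ≡⟨ cong₂ _-ℤ_ (b-interior k (trans (+-suc _ (suc p)) 1+k+1+R+1+p≡N) refl)
                    (b-interior k 1+k+1+R+1+p≡N (+-suc k (suc R))) ⟩
    (+ n -ℤ count≥ (suc (suc p)) (suc R)) -ℤ (+ n -ℤ count≥ (suc p) (suc (suc R)))
      ≡⟨ [a-x]-[a-y]≡y-x (+ n) (count≥ (suc (suc p)) (suc R)) (count≥ (suc p) (suc (suc R))) ⟩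
    count≥ (suc p) (suc (suc R)) -ℤ count≥ (suc (suc p)) (suc R) ∎

  diagonalStep-last : ∀ K R → suc K + suc R ≡ N →
    diagonalStep (suc R) (suc K) ≡ + suc K -ℤ count≥ 1 (suc R)
  diagonalStep-last K R 1+K+1+R≡N = begin
    b (suc K) (K + suc R) -ℤ b (suc K) (suc (K + suc R))
      ≡⟨ cong₂ _-ℤ_ (b-interior K (trans (+-comm _ 1) 1+K+1+R≡N) refl)
                    (trans (cong (b (suc K)) 1+K+1+R≡N) (b-boundary K)) ⟩
    (+ n -ℤ count≥ 1 (suc R)) -ℤ (+ n -ℤ + suc K)
      ≡⟨ [a-x]-[a-y]≡y-x (+ n) (count≥ 1 (suc R)) (+ suc K) ⟩
    + suc K -ℤ count≥ 1 (suc R) ∎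

  diagonalSteps-plus-entries : ∀ K R → K + suc R ≡ N →
    ∑[ k < K ] diagonalStep (suc R) (suc k) +ℤ ∑[ q < K ] count≡ (suc q) (suc R) ≡ + K
  diagonalSteps-plus-entries zero    R _          = refl
  diagonalSteps-plus-entries (suc K) R 1+K+1+R≡N = begin
    (∑[ k < K ] diagonalStep r (suc k) +ℤ diagonalStep r (suc K)) +ℤ (∑ K E +ℤ E K)
      ≡⟨ cong₂ (λ x y → (x +ℤ y) +ℤ (∑ K E +ℤ E K)) interior (diagonalStep-last K R 1+K+1+R≡N) ⟩
    (∑ K h +ℤ (+ suc K -ℤ A 0)) +ℤ (∑ K E +ℤ E K)
      ≡⟨ interchange ℤ.+-commutativeSemigroup (∑ K h) _ (∑ K E) (E K) ⟩
    (∑ K h +ℤ ∑ K E) +ℤ ((+ suc K -ℤ A 0) +ℤ E K)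
      ≡⟨ cong (_+ℤ ((+ suc K -ℤ A 0) +ℤ E K)) telescoped ⟩
    (A 0 -ℤ E K) +ℤ ((+ suc K -ℤ A 0) +ℤ E K)
      ≡⟨ [a-e]+[[k-a]+e]≡k (A 0) (E K) (+ suc K) ⟩
    + suc K ∎
    where
    r : ℕ
    r = suc R
    A E h : ℕ → ℤ
    A q = count≥ (suc q) r
    E q = count≡ (suc q) r
    h q = count≥ (suc q) (suc r) -ℤ A (suc q)

    row-of : ∀ k → k < K → suc k + r + suc (K ∸ suc k) ≡ N
    row-of k k<K = begin
      suc k + r + suc (K ∸ suc k)   ≡⟨ shuffle (suc k) r (K ∸ suc k) ⟩
      suc (suc k + (K ∸ suc k)) + r ≡⟨ cong (λ z → suc z + r) (m+[n∸m]≡n k<K) ⟩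
      suc K + r                     ≡⟨ 1+K+1+R≡N ⟩
      N                             ∎
      where
      shuffle : ∀ a b x → a + b + suc x ≡ suc (a + x) + b
      shuffle = ℕ-Solver.solve-∀

    interior : ∑[ k < K ] diagonalStep r (suc k) ≡ ∑ K h
    interior = trans (∑-cong K (λ k k<K → diagonalStep-interior k R (K ∸ suc k) (row-of k k<K)))
                     (sym (∑-reverse K h))

    K+1+r≡N : K + suc r ≡ N
    K+1+r≡N = trans (+-suc K r) 1+K+1+R≡N

    last-row : A K ≡ E K
    last-row = begin
      A K                            ≡⟨ count≥-split (suc K) r ⟩
      count≥ (suc K) (suc r) +ℤ E K  ≡⟨ cong (_+ℤ E K) (count≥-vanishes K K+1+r≡N ≤-refl) ⟩
      0ℤ +ℤ E K                      ≡⟨ ℤ.+-identityˡ (E K) ⟩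
      E K                            ∎

    telescoped : ∑ K h +ℤ ∑ K E ≡ A 0 -ℤ E K
    telescoped = begin
      ∑ K h +ℤ ∑ K E                  ≡⟨ ∑-distrib-+ K h E ⟨
      ∑[ q < K ] (h q +ℤ E q)         ≡⟨ ∑-cong K (λ q _ → row-difference q) ⟩
      ∑[ q < K ] (A q -ℤ A (suc q))   ≡⟨ ∑-telescope K A ⟩
      A 0 -ℤ A K                      ≡⟨ cong (A 0 -ℤ_) last-row ⟩
      A 0 -ℤ E K                      ∎
      where
      row-difference : ∀ q → h q +ℤ E q ≡ A q -ℤ A (suc q)
      row-difference q = trans ([x-y]+e≡[x+e]-y (count≥ (suc q) (suc r)) (A (suc q)) (E q))
                               (cong (_-ℤ A (suc q)) (sym (count≥-split (suc q) r)))

  row1-count≥ : ∀ K t → K + suc t ≡ N → count≥ 1 (suc t) ≡ ∑[ l < K ] χ (suc t ≤ᵇ c 1 (suc l))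
  row1-count≥ K t K+1+t≡N = ∑-truncate _ (subst (K ≤_) K+1+t≡N (m≤m+n K (suc t))) λ l K≤l _ →
    χ-does-false (_ ≤? _) (λ t<c → <⇒≱ t<c (entry≤ 0 l K+1+t≡N K≤l))

  row1-count≡ : ∀ K t → K + suc t ≡ N → count≡ 1 (suc t) ≡ ∑[ l < K ] χ (c 1 (suc l) ≡ᵇ suc t)
  row1-count≡ K t K+1+t≡N = ∑-truncate _ (subst (K ≤_) K+1+t≡N (m≤m+n K (suc t))) λ l K≤l _ →
    χ-does-false (_ ≟ _) (λ c≡1+t → 1+n≰n (subst (_≤ t) c≡1+t (entry≤ 0 l K+1+t≡N K≤l)))

  row1-count≥-full : ∀ s κ → suc s + suc κ ≡ N → c 1 (suc s) ≡ suc κ → count≥ 1 (suc κ) ≡ + suc s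
  row1-count≥-full s κ 1+s+1+κ≡N c≡1+κ = begin
    count≥ 1 (suc κ)                         ≡⟨ row1-count≥ (suc s) κ 1+s+1+κ≡N ⟩
    ∑[ l < suc s ] χ (suc κ ≤ᵇ c 1 (suc l))  ≡⟨ ∑-cong (suc s) (λ l → χ-does-true (_ ≤? _) ∘ above l) ⟩
    ∑[ l < suc s ] 1ℤ                        ≡⟨ ∑-ones (suc s) ⟩
    + suc s                                  ∎
    where
    above : ∀ l → l < suc s → suc κ ≤ c 1 (suc l)
    above l l<1+s = subst (_≤ c 1 (suc l)) c≡1+κ (row1-antitone (suc s) (s≤s z≤n) l<1+s)

  row1-count≥-short : ∀ s κ → suc s + suc κ ≡ N → c 1 (suc s) < suc κ → count≥ 1 (suc κ) <ℤ + suc s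
  row1-count≥-short s κ 1+s+1+κ≡N c<1+κ =
    ℤ.≤-<-trans (ℤ.≤-reflexive prefix) (ℤ.≤-<-trans (∑-χ≤ s _) (+<+ ≤-refl))
    where
    prefix : count≥ 1 (suc κ) ≡ ∑[ l < s ] χ (suc κ ≤ᵇ c 1 (suc l))
    prefix = begin
      count≥ 1 (suc κ)                   ≡⟨ row1-count≥ (suc s) κ 1+s+1+κ≡N ⟩
      ∑ s above +ℤ above s              ≡⟨ cong (∑ s above +ℤ_) (χ-does-false (_ ≤? _) (<⇒≱ c<1+κ)) ⟩
      ∑ s above +ℤ 0ℤ                   ≡⟨ ℤ.+-identityʳ _ ⟩
      ∑ s above                         ∎
      where
      above : ℕ → ℤ
      above l = χ (suc κ ≤ᵇ c 1 (suc l))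

  b-last-column : ∀ s κ → suc s + suc κ ≡ N → b (suc s) (N ∸ 1) ≡ + n -ℤ count≥ 1 (suc κ)
  b-last-column s κ 1+s+1+κ≡N = b-interior s (m∸n+n≡m 1≤N) (cong (_∸ 1) 1+s+1+κ≡N)
    where
    1≤N : 1 ≤ N
    1≤N = subst (1 ≤_) 1+s+1+κ≡N (s≤s z≤n)

  lastColumnχ : ℕ → ℤ
  lastColumnχ s = χ (does ((+ n -ℤ + s) <ℤ? b s (N ∸ 1)))

  lastColumnχ-complement : ∀ {s κ} → 1 ≤ s → 1 ≤ κ → s + κ ≡ N → lastColumnχ s +ℤ χ (c 1 s ≡ᵇ κ) ≡ 1ℤ
  lastColumnχ-complement {suc s} {suc κ} _ _ 1+s+1+κ≡N with c 1 (suc s) ≟ suc κ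
  ... | yes c≡1+κ = cong₂ _+ℤ_ (χ-does-false (_ <ℤ? _) not-below) (χ-does-true (_ ≟ _) c≡1+κ)
    where
    not-below : ¬ (+ n -ℤ + suc s <ℤ b (suc s) (N ∸ 1))
    not-below below = ℤ.<-irrefl refl (subst (_ <ℤ_) b≡n-[1+s] below)
      where
      b≡n-[1+s] : b (suc s) (N ∸ 1) ≡ + n -ℤ + suc s
      b≡n-[1+s] = trans (b-last-column s κ 1+s+1+κ≡N)
                        (cong (+ n -ℤ_) (row1-count≥-full s κ 1+s+1+κ≡N c≡1+κ))
  ... | no c≢1+κ = cong₂ _+ℤ_ (χ-does-true (_ <ℤ? _) below) (χ-does-false (_ ≟ _) c≢1+κ)
    where
    c<1+κ : c 1 (suc s) < suc κ
    c<1+κ = ≤∧≢⇒< (entry≤ 0 s (trans (+-suc s (suc κ)) 1+s+1+κ≡N) ≤-refl) c≢1+κ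
    below : + n -ℤ + suc s <ℤ b (suc s) (N ∸ 1)
    below = subst (_ <ℤ_) (sym (b-last-column s κ 1+s+1+κ≡N))
      (ℤ.+-monoʳ-< (+ n) (ℤ.neg-mono-< (row1-count≥-short s κ 1+s+1+κ≡N c<1+κ)))

  countSat-∑ : ∀ R → + countSat n m (suc R) c ≡ ∑[ k < R ] χ (c 1 (N ∸ suc k) ≡ᵇ suc k)
  countSat-∑ R = countᵇ-range _ {1} {R} refl

  lastColumnχ-plus-countSat : ∀ lo R → 1 ≤ lo → lo + R ≡ N →
    ∑[ k < R ] lastColumnχ (lo + k) +ℤ + countSat n m (suc R) c ≡ + R
  lastColumnχ-plus-countSat lo R 1≤lo lo+R≡N = begin
    ∑[ k < R ] lastColumnχ (lo + k) +ℤ + countSat n m (suc R) c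
      ≡⟨ cong₂ _+ℤ_ (∑-reverse R (λ k → lastColumnχ (lo + k))) (countSat-∑ R) ⟩
    ∑[ k < R ] lastColumnχ (lo + (R ∸ suc k)) +ℤ ∑[ k < R ] χ (c 1 (N ∸ suc k) ≡ᵇ suc k)
      ≡⟨ ∑-distrib-+ R _ _ ⟨
    ∑[ k < R ] (lastColumnχ (lo + (R ∸ suc k)) +ℤ χ (c 1 (N ∸ suc k) ≡ᵇ suc k))
      ≡⟨ ∑-cong R complement ⟩
    ∑[ k < R ] 1ℤ
      ≡⟨ ∑-ones R ⟩
    + R ∎
    where
    complement : ∀ k → k < R → lastColumnχ (lo + (R ∸ suc k)) +ℤ χ (c 1 (N ∸ suc k) ≡ᵇ suc k) ≡ 1ℤ
    complement k k<R =
      subst (λ j → lastColumnχ (lo + (R ∸ suc k)) +ℤ χ (c 1 j ≡ᵇ suc k) ≡ 1ℤ) (sym column)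
            (lastColumnχ-complement (≤-trans 1≤lo (m≤m+n lo _)) (s≤s z≤n) s+1+k≡N)
      where
      s+1+k≡N : lo + (R ∸ suc k) + suc k ≡ N
      s+1+k≡N = trans (+-assoc lo _ (suc k)) (trans (cong (λ x → lo + x) (m∸n+n≡m k<R)) lo+R≡N)
      column : N ∸ suc k ≡ lo + (R ∸ suc k)
      column = trans (cong (_∸ suc k) (sym s+1+k≡N)) (m+n∸n≡m _ (suc k))

  Ubar-formula : ∀ r → 1 ≤ r → r ≤ N → Ubar n m r c ≡ + (countEntries n m r c + countSat n m r c)
  Ubar-formula (suc R) _ r≤N = begin
    + (N ∸ 1) -ℤ (S₁ +ℤ S₂)
      ≡⟨ cong (λ x → + x -ℤ (S₁ +ℤ S₂)) N∸1≡K+R ⟩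
    + (K + R) -ℤ (S₁ +ℤ S₂)
      ≡⟨ complements-difference S₁ S₂ (+ countEntries n m (suc R) c) _ first-sum second-sum ⟩
    + (countEntries n m (suc R) c + countSat n m (suc R) c) ∎
    where
    K : ℕ
    K = N ∸ suc R
    K+1+R≡N : K + suc R ≡ N
    K+1+R≡N = m∸n+n≡m r≤N
    N∸1≡K+R : N ∸ 1 ≡ K + R
    N∸1≡K+R = trans (cong (_∸ 1) (sym K+1+R≡N)) (+-∸-assoc K (s≤s z≤n))
    S₁ S₂ : ℤ
    S₁ = sumℤ (diagonalStep (suc R)) (range 1 K)
    S₂ = sumℤ lastColumnχ (range (K + 1) (N ∸ 1))
    first-sum : S₁ +ℤ + countEntries n m (suc R) c ≡ + K
    first-sum = trans (cong₂ _+ℤ_ (sumℤ-range (diagonalStep (suc R)) {1} {K} refl)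
                                  (countEntries-rows K R K+1+R≡N))
                      (diagonalSteps-plus-entries K R K+1+R≡N)
    K+1+R≡1+[N∸1] : K + 1 + R ≡ suc (N ∸ 1)
    K+1+R≡1+[N∸1] = trans (+-assoc K 1 R) (trans K+1+R≡N (+-∸-assoc 1 (≤-trans (s≤s z≤n) r≤N)))
    second-sum : S₂ +ℤ + countSat n m (suc R) c ≡ + R
    second-sum = trans (cong (_+ℤ + countSat n m (suc R) c)
                             (sumℤ-range lastColumnχ {K + 1} {R} K+1+R≡1+[N∸1]))
                        (lastColumnχ-plus-countSat (K + 1) R (m≤n+m 1 K) (trans (+-assoc K 1 R) K+1+R≡N))

  Ubar-N : 1 ≤ N → Ubar n m N c ≡ + countSat n m N c
  Ubar-N 1≤N = begin
    Ubar n m N c                                      ≡⟨ Ubar-formula N 1≤N ≤-refl ⟩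
    + countEntries n m N c +ℤ + countSat n m N c      ≡⟨ cong (_+ℤ + countSat n m N c) no-entries ⟩
    0ℤ +ℤ + countSat n m N c                          ≡⟨ ℤ.+-identityˡ _ ⟩
    + countSat n m N c                                ∎
    where
    1+[N∸1]≡N : suc (N ∸ 1) ≡ N
    1+[N∸1]≡N = sym (+-∸-assoc 1 1≤N)
    no-entries : + countEntries n m N c ≡ 0ℤ
    no-entries = subst (λ r → + countEntries n m r c ≡ 0ℤ) 1+[N∸1]≡N
                       (countEntries-rows 0 (N ∸ 1) 1+[N∸1]≡N)

  countSat-saturated : + countSat n m N c ≡ + saturated n m c
  countSat-saturated = begin
    + countSat n m N c                            ≡⟨ countᵇ-range _ {1} {M} refl ⟩
    ∑[ k < M ] χ (c 1 (N ∸ suc k) ≡ᵇ suc k)       ≡⟨ ∑-cong M reindex ⟩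
    ∑[ k < M ] χ (saturatedAt (suc (M ∸ suc k)))  ≡⟨ ∑-reverse M (λ l → χ (saturatedAt (suc l))) ⟨
    ∑[ l < M ] χ (saturatedAt (suc l))            ≡⟨ ∑-truncate _ (m∸n≤m N 1) beyond ⟨
    ∑[ l < N ] χ (saturatedAt (suc l))            ≡⟨ countᵇ-range _ {1} {N} refl ⟨
    + saturated n m c                             ∎
    where
    M : ℕ
    M = N ∸ 1
    saturatedAt : ℕ → Bool
    saturatedAt j = (c 1 j ≡ᵇ (N ∸ j)) ∧ (0 <ᵇ c 1 j)

    reindex : ∀ k → k < M → χ (c 1 (N ∸ suc k) ≡ᵇ suc k) ≡ χ (saturatedAt (suc (M ∸ suc k)))
    reindex k k<M = begin
      χ (c 1 j ≡ᵇ suc k)                     ≡⟨ cong χ (≡ᵇ-suc-∧-positive (c 1 j) k) ⟨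
      χ ((c 1 j ≡ᵇ suc k) ∧ (0 <ᵇ c 1 j))    ≡⟨ cong (λ v → χ ((c 1 j ≡ᵇ v) ∧ (0 <ᵇ c 1 j))) N∸j≡1+k ⟨
      χ (saturatedAt j)                      ≡⟨ cong (χ ∘ saturatedAt) j≡1+[M∸1+k] ⟩
      χ (saturatedAt (suc (M ∸ suc k)))      ∎
      where
      j : ℕ
      j = N ∸ suc k
      N∸j≡1+k : N ∸ j ≡ suc k
      N∸j≡1+k = m∸[m∸n]≡n (≤-trans k<M (m∸n≤m N 1))
      j≡1+[M∸1+k] : j ≡ suc (M ∸ suc k)
      j≡1+[M∸1+k] = trans (sym (∸-+-assoc N 1 k)) (+-∸-assoc 1 k<M)

    beyond : ∀ l → M ≤ l → l < N → χ (saturatedAt (suc l)) ≡ 0ℤ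
    beyond l M≤l l<N = begin
      χ (saturatedAt (suc l))        ≡⟨ cong (λ v → χ ((v ≡ᵇ N ∸ suc l) ∧ (0 <ᵇ v))) c≡0 ⟩
      χ ((0 ≡ᵇ N ∸ suc l) ∧ false)   ≡⟨ cong χ (∧-zeroʳ _) ⟩
      0ℤ                             ∎
      where
      c≡0 : c 1 (suc l) ≡ 0
      c≡0 = n≤0⇒n≡0 (entry≤ 0 l (m∸n+n≡m (≤-trans (s≤s z≤n) l<N)) M≤l)

  penultimate-counts : ∀ P → suc (suc P) ≡ N →
    + countEntries n m (suc P) c +ℤ + countSat n m (suc P) c ≡ + countSat n m N c
  penultimate-counts P 2+P≡N = begin
    + countEntries n m (suc P) c +ℤ + countSat n m (suc P) c  ≡⟨ cong₂ _+ℤ_ entries (countSat-∑ P) ⟩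
    χ (c 1 1 ≡ᵇ suc P) +ℤ ∑ P countSatTerm                    ≡⟨ ℤ.+-comm _ (∑ P countSatTerm) ⟩
    ∑ P countSatTerm +ℤ χ (c 1 1 ≡ᵇ suc P)
      ≡⟨ cong (λ j → ∑ P countSatTerm +ℤ χ (c 1 j ≡ᵇ suc P)) N∸1+P≡1 ⟨
    ∑ (suc P) countSatTerm                                     ≡⟨ countSat-∑ (suc P) ⟨
    + countSat n m (suc (suc P)) c                            ≡⟨ cong (λ r → + countSat n m r c) 2+P≡N ⟩
    + countSat n m N c                                        ∎
    where
    countSatTerm : ℕ → ℤ
    countSatTerm k = χ (c 1 (N ∸ suc k) ≡ᵇ suc k)
    N∸1+P≡1 : N ∸ suc P ≡ 1
    N∸1+P≡1 = trans (cong (_∸ suc P) (sym 2+P≡N)) (m+n∸n≡m 1 (suc P))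
    entries : + countEntries n m (suc P) c ≡ χ (c 1 1 ≡ᵇ suc P)
    entries = begin
      + countEntries n m (suc P) c    ≡⟨ countEntries-rows 1 P 2+P≡N ⟩
      0ℤ +ℤ count≡ 1 (suc P)          ≡⟨ ℤ.+-identityˡ _ ⟩
      count≡ 1 (suc P)                ≡⟨ row1-count≡ 1 P 2+P≡N ⟩
      0ℤ +ℤ χ (c 1 1 ≡ᵇ suc P)        ≡⟨ ℤ.+-identityˡ _ ⟩
      χ (c 1 1 ≡ᵇ suc P)              ∎

  Ubar-N∸1≡Ubar-N : 2 ≤ N → Ubar n m (N ∸ 1) c ≡ Ubar n m N c
  Ubar-N∸1≡Ubar-N 2≤N = begin
    Ubar n m (N ∸ 1) c                                         ≡⟨ cong (λ r → Ubar n m r c) N∸1≡1+P ⟩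
    Ubar n m (suc P) c                                         ≡⟨ Ubar-formula (suc P) (s≤s z≤n) 1+P≤N ⟩
    + countEntries n m (suc P) c +ℤ + countSat n m (suc P) c   ≡⟨ penultimate-counts P 2+P≡N ⟩
    + countSat n m N c                                         ≡⟨ Ubar-N (≤-trans (s≤s z≤n) 2≤N) ⟨
    Ubar n m N c                                               ∎
    where
    P : ℕ
    P = N ∸ 2
    2+P≡N : suc (suc P) ≡ N
    2+P≡N = trans (+-comm 2 P) (m∸n+n≡m 2≤N)
    N∸1≡1+P : N ∸ 1 ≡ suc P
    N∸1≡1+P = cong (_∸ 1) (sym 2+P≡N)
    1+P≤N : suc P ≤ N
    1+P≤N = subst (suc P ≤_) 2+P≡N (n≤1+n (suc P))

theorem4p1 : (n m : ℕ) → 1 ≤ n → (c : PlaneArray) → InC n m c →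
      ((r : ℕ) → 1 ≤ r → r ≤ n + m →
         Ubar n m r c ≡ + (countEntries n m r c + countSat n m r c))
      × (Ubar n m 1 c ≡ + countEntries n m 1 c)
      × (Ubar n m (n + m) c ≡ + saturated n m c)
      × (2 ≤ n + m → Ubar n m (n + m ∸ 1) c ≡ Ubar n m (n + m) c)
theorem4p1 n m 1≤n c c∈C =
    Ubar-formula c∈C
  , trans (Ubar-formula c∈C 1 ≤-refl 1≤N) (cong +_ (+-identityʳ _))
  , trans (Ubar-N c∈C 1≤N) (countSat-saturated c∈C)
  , Ubar-N∸1≡Ubar-N c∈C
  where
  1≤N : 1 ≤ n + m
  1≤N = ≤-trans 1≤n (m≤m+n n m)
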